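{- Let $\Sigma=\{0,1\}$ and $\varepsilon$ the empty word. The morphism $\varphi:\Sigma^*\times\Sigma^*\to{\rm SL}(3,\mathbb{Q})$ defined on generators by $\varphi((0,\varepsilon))=\begin{pmatrix}4&0&0\\0&\frac12&0\\0&0&\frac12\end{pmatrix}$, $\varphi((1,\varepsilon))=\begin{pmatrix}9&\frac13&0\\0&\frac13&0\\0&0&\frac13\end{pmatrix}$, $\varphi((\varepsilon,0))=\begin{pmatrix}\frac12&0&0\\0&\frac12&0\\0&0&4\end{pmatrix}$, $\varphi((\varepsilon,1))=\begin{pmatrix}\frac13&0&0\\0&\frac13&0\\0&\frac13&9\end{pmatrix}$ is an embedding (an injective morphism).
   Context: $\Sigma^*\times\Sigma^*$ is the direct product monoid of pairs of words with componentwise concatenation, generated by $(0,\varepsilon),(1,\varepsilon),(\varepsilon,0),(\varepsilon,1)$; a morphism is a map preserving products. ${\rm SL}(3,\mathbb{Q})$ is the group of rational $3\times3$ matrices of determinant $1$. -}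

module Defs where

open import Data.Bool using (Bool; true; false)
open import Data.Fin using (Fin; zero; suc)
open import Data.List using (List; []; _∷_; _++_)
open import Data.Nat using (ℕ)
open import Data.Integer using (+_)
open import Data.Product using (_×_; _,_)
open import Data.Rational using (ℚ; _+_; _*_; _-_; _/_; 0ℚ; 1ℚ)
open import Data.Vec using (Vec; []; _∷_; lookup)
open import Relation.Binary.PropositionalEquality using (_≡_)

-- Σ = {0,1}, encoded as Bool (false = 0, true = 1); Σ* = List Bool.
Word : Set
Word = List Bool

WordPair : Set
WordPair = Word × Word

_·_ : WordPair → WordPair → WordPair
(u , v) · (u' , v') = (u ++ u') , (v ++ v')

εε : WordPair
εε = [] , []

Mat : Set
Mat = Fin 3 → Fin 3 → ℚ

_≈_ : Mat → Mat → Set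
A ≈ B = ∀ i j → A i j ≡ B i j

fromRows : Vec (Vec ℚ 3) 3 → Mat
fromRows rs i j = lookup (lookup rs i) j

_⊗_ : Mat → Mat → Mat
(A ⊗ B) i j = A i zero * B zero j + A i (suc zero) * B (suc zero) j
            + A i (suc (suc zero)) * B (suc (suc zero)) j

I₃ : Mat
I₃ = fromRows ((1ℚ ∷ 0ℚ ∷ 0ℚ ∷ []) ∷ (0ℚ ∷ 1ℚ ∷ 0ℚ ∷ []) ∷ (0ℚ ∷ 0ℚ ∷ 1ℚ ∷ []) ∷ [])

det : Mat → ℚ
det A = a 0 0 * (a 1 1 * a 2 2 - a 1 2 * a 2 1)
      - a 0 1 * (a 1 0 * a 2 2 - a 1 2 * a 2 0)
      + a 0 2 * (a 1 0 * a 2 1 - a 1 1 * a 2 0)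
  where
  ix : ℕ → Fin 3
  ix 0 = zero
  ix 1 = suc zero
  ix _ = suc (suc zero)
  a : ℕ → ℕ → ℚ
  a i j = A (ix i) (ix j)

q : ℕ → ℚ
q n = + n / 1

half third : ℚ
half  = + 1 / 2
third = + 1 / 3

A₀ A₁ B₀ B₁ : Mat
A₀ = fromRows ((q 4 ∷ 0ℚ ∷ 0ℚ ∷ []) ∷ (0ℚ ∷ half ∷ 0ℚ ∷ []) ∷ (0ℚ ∷ 0ℚ ∷ half ∷ []) ∷ [])
A₁ = fromRows ((q 9 ∷ third ∷ 0ℚ ∷ []) ∷ (0ℚ ∷ third ∷ 0ℚ ∷ []) ∷ (0ℚ ∷ 0ℚ ∷ third ∷ []) ∷ [])
B₀ = fromRows ((half ∷ 0ℚ ∷ 0ℚ ∷ []) ∷ (0ℚ ∷ half ∷ 0ℚ ∷ []) ∷ (0ℚ ∷ 0ℚ ∷ q 4 ∷ []) ∷ [])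
B₁ = fromRows ((third ∷ 0ℚ ∷ 0ℚ ∷ []) ∷ (0ℚ ∷ third ∷ 0ℚ ∷ []) ∷ (0ℚ ∷ third ∷ q 9 ∷ []) ∷ [])

genL genR : Bool → Mat
genL false = A₀
genL true  = A₁
genR false = B₀
genR true  = B₁

-- Extension of the generator assignment to products:
-- (a₁…aₙ , b₁…bₘ) = (a₁,ε)…(aₙ,ε)(ε,b₁)…(ε,bₘ)
φL φR : Word → Mat
φL []      = I₃
φL (a ∷ u) = genL a ⊗ φL u
φR []      = I₃
φR (b ∷ v) = genR b ⊗ φR v

φ : WordPair → Mat
φ (u , v) = φL u ⊗ φR v

module Submission where

-- Read a word u as a mixed-radix numeral, letter 0 being the digit 0 in radix 8 and letter 1 the
-- digit 1 in radix 27, least significant letter first; let value u be the number and weight u the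
-- product of the radices. Then φ(u,ε) = d·[[weight u, value u, 0], [0, 1, 0], [0, 0, 1]] with
-- d³·weight u = 1, and φ(ε,v) is the mirror image of φ(v,ε) under the antidiagonal permutation.
-- The left and right generators commute, so φ is a morphism, and they have determinant 1.
-- Dividing the entries of φ(u,v) by its central entry, which is invertible because det = 1,
-- recovers value and weight of u and v. Finally, since 26·value u < weight u, the last letter of u
-- is 1 exactly when weight u ≤ 27·value u; peeling it off shows that (weight, value) determines u.

open import Defs
open import Data.Bool using (Bool; true; false)
open import Data.List using (List; []; _∷_; _++_)
open import Data.Product using (_×_; _,_)
open import Data.Rational using (1ℚ)
open import Relation.Binary.PropositionalEquality
  using (_≡_; refl; sym; trans; cong; cong₂; module ≡-Reasoning)

module MixedRadix where

  open import Data.Empty using (⊥-elim)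
  open import Data.List using (_∷ʳ_)
  open import Data.List.Reverse using (Reverse; []; _∶_∶ʳ_; reverseView)
  open import Data.Nat using (ℕ; suc; _+_; _*_; _<_; _≤_; s≤s; z≤n; NonZero)
  import Data.Nat.Properties as ℕ
  open import Data.Nat.Tactic.RingSolver using (solve-∀)
  open import Relation.Binary.PropositionalEquality using (subst₂; _≢_)

  radix digit : Bool → ℕ
  radix false = 8
  radix true  = 27
  digit false = 0
  digit true  = 1

  weight value : Word → ℕ
  weight []      = 1
  weight (x ∷ u) = radix x * weight u
  value []      = 0
  value (x ∷ u) = digit x + radix x * value u

  radix-nonZero : ∀ x → NonZero (radix x)
  radix-nonZero false = _
  radix-nonZero true  = _

  weight-∷ʳ : ∀ u x → weight (u ∷ʳ x) ≡ weight u * radix x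
  weight-∷ʳ []      x = ℕ.*-comm (radix x) 1
  weight-∷ʳ (y ∷ u) x =
    trans (cong (radix y *_) (weight-∷ʳ u x)) (sym (ℕ.*-assoc (radix y) (weight u) (radix x)))

  value-∷ʳ : ∀ u x → value (u ∷ʳ x) ≡ value u + digit x * weight u
  value-∷ʳ []      false = refl
  value-∷ʳ []      true  = refl
  value-∷ʳ (y ∷ u) x rewrite value-∷ʳ u x = distribute (digit y) (radix y) (value u) (digit x) (weight u)
    where
    distribute : ∀ a r v b w → a + r * (v + b * w) ≡ a + r * v + b * (r * w)
    distribute = solve-∀

  26*digit<radix : ∀ x → 26 * digit x < radix x
  26*digit<radix false = s≤s z≤n
  26*digit<radix true  = ℕ.≤-refl

  26*value<weight : ∀ u → 26 * value u < weight u
  26*value<weight []      = ℕ.≤-refl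
  26*value<weight (x ∷ u) = begin-strict
    26 * (d + r * v)       ≡⟨ rearrange d r v ⟩
    26 * d + r * (26 * v)  <⟨ ℕ.+-monoˡ-< (r * (26 * v)) (26*digit<radix x) ⟩
    r + r * (26 * v)       ≡⟨ ℕ.*-suc r (26 * v) ⟨
    r * suc (26 * v)     ≤⟨ ℕ.*-monoʳ-≤ r (26*value<weight u) ⟩
    r * weight u           ∎
    where
    open ℕ.≤-Reasoning
    d r v : ℕ
    d = digit x
    r = radix x
    v = value u
    rearrange : ∀ d r v → 26 * (d + r * v) ≡ 26 * d + r * (26 * v)
    rearrange = solve-∀

  last-false : ∀ u → 27 * value (u ∷ʳ false) < weight (u ∷ʳ false)
  last-false u = begin-strict
    27 * value (u ∷ʳ false)  ≡⟨ cong (27 *_) (trans (value-∷ʳ u false) (ℕ.+-identityʳ v)) ⟩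
    27 * v                   ≤⟨ ℕ.*-monoˡ-≤ v (ℕ.m≤m+n 27 181) ⟩
    208 * v                  ≡⟨ ℕ.*-assoc 8 26 v ⟩
    8 * (26 * v)             <⟨ ℕ.*-monoʳ-< 8 (26*value<weight u) ⟩
    8 * weight u             ≡⟨ ℕ.*-comm 8 (weight u) ⟩
    weight u * 8             ≡⟨ weight-∷ʳ u false ⟨
    weight (u ∷ʳ false)      ∎
    where
    open ℕ.≤-Reasoning
    v : ℕ
    v = value u

  last-true : ∀ u → weight (u ∷ʳ true) ≤ 27 * value (u ∷ʳ true)
  last-true u = begin
    weight (u ∷ʳ true)          ≡⟨ weight-∷ʳ u true ⟩
    weight u * 27               ≡⟨ ℕ.*-comm (weight u) 27 ⟩
    27 * weight u               ≤⟨ ℕ.*-monoʳ-≤ 27 (ℕ.m≤n+m (weight u) (value u)) ⟩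
    27 * (value u + weight u)   ≡⟨ cong (λ w → 27 * (value u + w)) (ℕ.*-identityˡ (weight u)) ⟨
    27 * (value u + 1 * weight u) ≡⟨ cong (27 *_) (value-∷ʳ u true) ⟨
    27 * value (u ∷ʳ true)      ∎
    where open ℕ.≤-Reasoning

  radix≢1 : ∀ x → radix x ≢ 1
  radix≢1 false ()
  radix≢1 true  ()

  weight-∷ʳ≢1 : ∀ u x → weight (u ∷ʳ x) ≢ 1
  weight-∷ʳ≢1 u x w≡1 = radix≢1 x (ℕ.m*n≡1⇒n≡1 (weight u) (radix x) (trans (sym (weight-∷ʳ u x)) w≡1))

  last-letter-injective : ∀ u u' x x' → weight (u ∷ʳ x) ≡ weight (u' ∷ʳ x') →
                          value (u ∷ʳ x) ≡ value (u' ∷ʳ x') → x ≡ x'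
  last-letter-injective u u' false false w≡ v≡ = refl
  last-letter-injective u u' true  true  w≡ v≡ = refl
  last-letter-injective u u' false true  w≡ v≡ =
    ⊥-elim (ℕ.<⇒≱ (subst₂ _<_ (cong (27 *_) v≡) w≡ (last-false u)) (last-true u'))
  last-letter-injective u u' true  false w≡ v≡ =
    ⊥-elim (ℕ.<⇒≱ (subst₂ _<_ (cong (27 *_) (sym v≡)) (sym w≡) (last-false u')) (last-true u))

  init-invariants : ∀ u u' x → weight (u ∷ʳ x) ≡ weight (u' ∷ʳ x) → value (u ∷ʳ x) ≡ value (u' ∷ʳ x)
                  → weight u ≡ weight u' × value u ≡ value u'
  init-invariants u u' x w≡ v≡ = weight≡ , value≡
    where
    weight≡ : weight u ≡ weight u'
    weight≡ = ℕ.*-cancelʳ-≡ (weight u) (weight u') (radix x) {{radix-nonZero x}}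
                (trans (sym (weight-∷ʳ u x)) (trans w≡ (weight-∷ʳ u' x)))
    value≡ : value u ≡ value u'
    value≡ = ℕ.+-cancelʳ-≡ (digit x * weight u) (value u) (value u')
               (trans (sym (value-∷ʳ u x)) (trans v≡ (trans (value-∷ʳ u' x)
                 (cong (λ w → value u' + digit x * w) (sym weight≡)))))

  weight-value-injective : ∀ u u' → weight u ≡ weight u' → value u ≡ value u' → u ≡ u'
  weight-value-injective u u' = viaReverse (reverseView u) (reverseView u')
    where
    viaReverse : ∀ {u u'} → Reverse u → Reverse u' →
                 weight u ≡ weight u' → value u ≡ value u' → u ≡ u'
    viaReverse []              []                 w≡ v≡ = refl
    viaReverse []              (s' ∶ _ ∶ʳ x')     w≡ v≡ = ⊥-elim (weight-∷ʳ≢1 s' x' (sym w≡))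
    viaReverse (s ∶ _ ∶ʳ x)    []                 w≡ v≡ = ⊥-elim (weight-∷ʳ≢1 s x w≡)
    viaReverse (s ∶ rs ∶ʳ x)   (s' ∶ rs' ∶ʳ x')   w≡ v≡ with last-letter-injective s s' x x' w≡ v≡
    ... | refl = let (w≡′ , v≡′) = init-invariants s s' x w≡ v≡
                 in cong (_∷ʳ x) (viaReverse rs rs' w≡′ v≡′)

open MixedRadix using (radix; digit; weight; value; weight-value-injective)

open import Data.Fin using (Fin; zero; suc; opposite)
open import Data.Fin.Properties using (all?)
open import Data.Nat as ℕ using (ℕ)
open import Data.Nat.Coprimality as Coprime using ()
open import Data.Integer as ℤ using (+_)
import Data.Integer.Properties as ℤ
open import Data.Rational using (ℚ; mkℚ; ↥_; toℚᵘ; _+_; _*_; 0ℚ)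
import Data.Rational.Properties as ℚ
open import Data.Rational.Unnormalised using (*≡*) renaming (_≃_ to _≃ᵘ_; _+_ to _+ᵘ_; _*_ to _*ᵘ_)
import Data.Rational.Unnormalised.Properties as ℚᵘ
open import Data.Rational.Solver using (module +-*-Solver)
open +-*-Solver
open import Data.Vec using ([]; _∷_)
open import Level using (0ℓ)
open import Relation.Binary using (Setoid; Decidable)
import Relation.Binary.Reasoning.Setoid as ≈-Reasoning
open import Relation.Nullary.Decidable using (True; toWitness)

q≡mkℚ : ∀ n → q n ≡ mkℚ (+ n) 0 (Coprime.sym (Coprime.1-coprimeTo n))
q≡mkℚ n = ℚ.normalize-coprime (Coprime.sym (Coprime.1-coprimeTo n))

q-injective : ∀ {m n} → q m ≡ q n → m ≡ n
q-injective {m} {n} eq = ℤ.+-injective (cong ↥_ (trans (sym (q≡mkℚ m)) (trans eq (q≡mkℚ n))))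

q-homo-+ : ∀ m n → q (m ℕ.+ n) ≡ q m + q n
q-homo-+ m n = ℚ.toℚᵘ-injective (ℚᵘ.≃-trans unnormalised (ℚᵘ.≃-sym (ℚ.toℚᵘ-homo-+ (q m) (q n))))
  where
  unnormalised : toℚᵘ (q (m ℕ.+ n)) ≃ᵘ (toℚᵘ (q m) +ᵘ toℚᵘ (q n))
  unnormalised rewrite q≡mkℚ (m ℕ.+ n) | q≡mkℚ m | q≡mkℚ n = *≡* (cong (ℤ._* + 1)
    (trans (ℤ.pos-+ m n) (sym (cong₂ ℤ._+_ (ℤ.*-identityʳ (+ m)) (ℤ.*-identityʳ (+ n))))))

q-homo-* : ∀ m n → q (m ℕ.* n) ≡ q m * q n
q-homo-* m n = ℚ.toℚᵘ-injective (ℚᵘ.≃-trans unnormalised (ℚᵘ.≃-sym (ℚ.toℚᵘ-homo-* (q m) (q n))))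
  where
  unnormalised : toℚᵘ (q (m ℕ.* n)) ≃ᵘ (toℚᵘ (q m) *ᵘ toℚᵘ (q n))
  unnormalised rewrite q≡mkℚ (m ℕ.* n) | q≡mkℚ m | q≡mkℚ n = *≡* (cong (ℤ._* + 1) (ℤ.pos-* m n))

*-cancelʳ-invertible : ∀ {x y s} t → s * t ≡ 1ℚ → x * s ≡ y * s → x ≡ y
*-cancelʳ-invertible {x} {y} {s} t st≡1 xs≡ys = begin
  x           ≡⟨ ℚ.*-identityʳ x ⟨
  x * 1ℚ      ≡⟨ cong (x *_) st≡1 ⟨
  x * (s * t) ≡⟨ ℚ.*-assoc x s t ⟨
  x * s * t   ≡⟨ cong (_* t) xs≡ys ⟩
  y * s * t   ≡⟨ ℚ.*-assoc y s t ⟩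
  y * (s * t) ≡⟨ cong (y *_) st≡1 ⟩
  y * 1ℚ      ≡⟨ ℚ.*-identityʳ y ⟩
  y           ∎
  where open ≡-Reasoning

pattern ₀ = zero
pattern ₁ = suc zero
pattern ₂ = suc (suc zero)

≈-setoid : Setoid 0ℓ 0ℓ
≈-setoid = record
  { Carrier       = Mat
  ; _≈_           = _≈_
  ; isEquivalence = record
    { refl  = λ _ _ → refl
    ; sym   = λ A≈B i j → sym (A≈B i j)
    ; trans = λ A≈B B≈C i j → trans (A≈B i j) (B≈C i j)
    }
  }

open Setoid ≈-setoid using () renaming (sym to ≈-sym; trans to ≈-trans)

_≈?_ : Decidable _≈_
A ≈? B = all? λ i → all? λ j → A i j ℚ.≟ B i j

≈-by-evaluation : ∀ A B → {True (A ≈? B)} → A ≈ B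
≈-by-evaluation A B {A≈B} = toWitness A≈B

⊗-cong : ∀ {A A' B B'} → A ≈ A' → B ≈ B' → (A ⊗ B) ≈ (A' ⊗ B')
⊗-cong A≈A' B≈B' i j =
  cong₂ _+_ (cong₂ _+_ (cong₂ _*_ (A≈A' i ₀) (B≈B' ₀ j)) (cong₂ _*_ (A≈A' i ₁) (B≈B' ₁ j)))
            (cong₂ _*_ (A≈A' i ₂) (B≈B' ₂ j))

⊗-congˡ : ∀ A {B C} → B ≈ C → (A ⊗ B) ≈ (A ⊗ C)
⊗-congˡ A = ⊗-cong {A} {A} (λ _ _ → refl)

⊗-congʳ : ∀ C {A B} → A ≈ B → (A ⊗ C) ≈ (B ⊗ C)
⊗-congʳ C A≈B = ⊗-cong {B = C} {B' = C} A≈B (λ _ _ → refl)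

⊗-assoc : ∀ A B C → ((A ⊗ B) ⊗ C) ≈ (A ⊗ (B ⊗ C))
⊗-assoc A B C i j = solve 15
  (λ a₀ a₁ a₂ b₀₀ b₀₁ b₀₂ b₁₀ b₁₁ b₁₂ b₂₀ b₂₁ b₂₂ c₀ c₁ c₂ →
     (a₀ :* b₀₀ :+ a₁ :* b₁₀ :+ a₂ :* b₂₀) :* c₀
       :+ (a₀ :* b₀₁ :+ a₁ :* b₁₁ :+ a₂ :* b₂₁) :* c₁
       :+ (a₀ :* b₀₂ :+ a₁ :* b₁₂ :+ a₂ :* b₂₂) :* c₂
     := a₀ :* (b₀₀ :* c₀ :+ b₀₁ :* c₁ :+ b₀₂ :* c₂)
       :+ a₁ :* (b₁₀ :* c₀ :+ b₁₁ :* c₁ :+ b₁₂ :* c₂)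
       :+ a₂ :* (b₂₀ :* c₀ :+ b₂₁ :* c₁ :+ b₂₂ :* c₂))
  refl (A i ₀) (A i ₁) (A i ₂)
       (B ₀ ₀) (B ₀ ₁) (B ₀ ₂) (B ₁ ₀) (B ₁ ₁) (B ₁ ₂) (B ₂ ₀) (B ₂ ₁) (B ₂ ₂)
       (C ₀ j) (C ₁ j) (C ₂ j)

⊗-identityˡ : ∀ A → (I₃ ⊗ A) ≈ A
⊗-identityˡ A ₀ j = solve 3 (λ a b c → con 1ℚ :* a :+ con 0ℚ :* b :+ con 0ℚ :* c := a) refl (A ₀ j) (A ₁ j) (A ₂ j)
⊗-identityˡ A ₁ j = solve 3 (λ a b c → con 0ℚ :* a :+ con 1ℚ :* b :+ con 0ℚ :* c := b) refl (A ₀ j) (A ₁ j) (A ₂ j)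
⊗-identityˡ A ₂ j = solve 3 (λ a b c → con 0ℚ :* a :+ con 0ℚ :* b :+ con 1ℚ :* c := c) refl (A ₀ j) (A ₁ j) (A ₂ j)

⊗-identityʳ : ∀ A → (A ⊗ I₃) ≈ A
⊗-identityʳ A i ₀ = solve 3 (λ a b c → a :* con 1ℚ :+ b :* con 0ℚ :+ c :* con 0ℚ := a) refl (A i ₀) (A i ₁) (A i ₂)
⊗-identityʳ A i ₁ = solve 3 (λ a b c → a :* con 0ℚ :+ b :* con 1ℚ :+ c :* con 0ℚ := b) refl (A i ₀) (A i ₁) (A i ₂)
⊗-identityʳ A i ₂ = solve 3 (λ a b c → a :* con 0ℚ :+ b :* con 0ℚ :+ c :* con 1ℚ := c) refl (A i ₀) (A i ₁) (A i ₂)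

⊗-interchange : ∀ A B C D → (B ⊗ C) ≈ (C ⊗ B) → ((A ⊗ B) ⊗ (C ⊗ D)) ≈ ((A ⊗ C) ⊗ (B ⊗ D))
⊗-interchange A B C D BC≈CB = begin
  (A ⊗ B) ⊗ (C ⊗ D)   ≈⟨ ⊗-assoc A B (C ⊗ D) ⟩
  A ⊗ (B ⊗ (C ⊗ D))   ≈⟨ ⊗-congˡ A (⊗-assoc B C D) ⟨
  A ⊗ ((B ⊗ C) ⊗ D)   ≈⟨ ⊗-congˡ A (⊗-congʳ D BC≈CB) ⟩
  A ⊗ ((C ⊗ B) ⊗ D)   ≈⟨ ⊗-congˡ A (⊗-assoc C B D) ⟩
  A ⊗ (C ⊗ (B ⊗ D))   ≈⟨ ⊗-assoc A C (B ⊗ D) ⟨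
  (A ⊗ C) ⊗ (B ⊗ D)   ∎
  where open ≈-Reasoning ≈-setoid

det-cong : ∀ {A B} → A ≈ B → det A ≡ det B
det-cong {A} {B} A≈B
  rewrite A≈B ₀ ₀ | A≈B ₀ ₁ | A≈B ₀ ₂ | A≈B ₁ ₀ | A≈B ₁ ₁ | A≈B ₁ ₂ | A≈B ₂ ₀ | A≈B ₂ ₁ | A≈B ₂ ₂ = refl

det-⊗ : ∀ A B → det (A ⊗ B) ≡ det A * det B
det-⊗ A B = solve 18
  (λ a₀₀ a₀₁ a₀₂ a₁₀ a₁₁ a₁₂ a₂₀ a₂₁ a₂₂ b₀₀ b₀₁ b₀₂ b₁₀ b₁₁ b₁₂ b₂₀ b₂₁ b₂₂ →
     let entry x₀ x₁ x₂ y₀ y₁ y₂ = x₀ :* y₀ :+ x₁ :* y₁ :+ x₂ :* y₂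
         Δ x₀₀ x₀₁ x₀₂ x₁₀ x₁₁ x₁₂ x₂₀ x₂₁ x₂₂ =
           x₀₀ :* (x₁₁ :* x₂₂ :- x₁₂ :* x₂₁) :- x₀₁ :* (x₁₀ :* x₂₂ :- x₁₂ :* x₂₀) :+ x₀₂ :* (x₁₀ :* x₂₁ :- x₁₁ :* x₂₀)
     in Δ (entry a₀₀ a₀₁ a₀₂ b₀₀ b₁₀ b₂₀) (entry a₀₀ a₀₁ a₀₂ b₀₁ b₁₁ b₂₁) (entry a₀₀ a₀₁ a₀₂ b₀₂ b₁₂ b₂₂)
          (entry a₁₀ a₁₁ a₁₂ b₀₀ b₁₀ b₂₀) (entry a₁₀ a₁₁ a₁₂ b₀₁ b₁₁ b₂₁) (entry a₁₀ a₁₁ a₁₂ b₀₂ b₁₂ b₂₂)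
          (entry a₂₀ a₂₁ a₂₂ b₀₀ b₁₀ b₂₀) (entry a₂₀ a₂₁ a₂₂ b₀₁ b₁₁ b₂₁) (entry a₂₀ a₂₁ a₂₂ b₀₂ b₁₂ b₂₂)
        := Δ a₀₀ a₀₁ a₀₂ a₁₀ a₁₁ a₁₂ a₂₀ a₂₁ a₂₂ :* Δ b₀₀ b₀₁ b₀₂ b₁₀ b₁₁ b₁₂ b₂₀ b₂₁ b₂₂)
  refl (A ₀ ₀) (A ₀ ₁) (A ₀ ₂) (A ₁ ₀) (A ₁ ₁) (A ₁ ₂) (A ₂ ₀) (A ₂ ₁) (A ₂ ₂)
       (B ₀ ₀) (B ₀ ₁) (B ₀ ₂) (B ₁ ₀) (B ₁ ₁) (B ₁ ₂) (B ₂ ₀) (B ₂ ₁) (B ₂ ₂)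

reverse : Mat → Mat
reverse A i j = A (opposite i) (opposite j)

reverse-cong : ∀ {A B} → A ≈ B → reverse A ≈ reverse B
reverse-cong A≈B i j = A≈B (opposite i) (opposite j)

reverse-⊗ : ∀ A B → reverse (A ⊗ B) ≈ (reverse A ⊗ reverse B)
reverse-⊗ A B i j = solve 6 (λ a₀ a₁ a₂ b₀ b₁ b₂ → a₀ :* b₀ :+ a₁ :* b₁ :+ a₂ :* b₂ := a₂ :* b₂ :+ a₁ :* b₁ :+ a₀ :* b₀)
  refl (A i′ ₀) (A i′ ₁) (A i′ ₂) (B ₀ j′) (B ₁ j′) (B ₂ j′)
  where
  i′ j′ : Fin 3
  i′ = opposite i
  j′ = opposite j

module Generated {Letter : Set} (g : Letter → Mat) (F : List Letter → Mat)
                 (F-[] : F [] ≈ I₃) (F-∷ : ∀ x u → F (x ∷ u) ≈ (g x ⊗ F u)) where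

  F-++ : ∀ u u' → F (u ++ u') ≈ (F u ⊗ F u')
  F-++ [] u' = begin
    F u'         ≈⟨ ⊗-identityˡ (F u') ⟨
    I₃ ⊗ F u'    ≈⟨ ⊗-congʳ (F u') F-[] ⟨
    F [] ⊗ F u'  ∎
    where open ≈-Reasoning ≈-setoid
  F-++ (x ∷ u) u' = begin
    F (x ∷ u ++ u')       ≈⟨ F-∷ x (u ++ u') ⟩
    g x ⊗ F (u ++ u')     ≈⟨ ⊗-congˡ (g x) (F-++ u u') ⟩
    g x ⊗ (F u ⊗ F u')    ≈⟨ ⊗-assoc (g x) (F u) (F u') ⟨
    (g x ⊗ F u) ⊗ F u'    ≈⟨ ⊗-congʳ (F u') (F-∷ x u) ⟨
    F (x ∷ u) ⊗ F u'      ∎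
    where open ≈-Reasoning ≈-setoid

  F-commute : ∀ {M} → (∀ x → (g x ⊗ M) ≈ (M ⊗ g x)) → ∀ u → (F u ⊗ M) ≈ (M ⊗ F u)
  F-commute {M} gM≈Mg [] = begin
    F [] ⊗ M  ≈⟨ ⊗-congʳ M F-[] ⟩
    I₃ ⊗ M    ≈⟨ ⊗-identityˡ M ⟩
    M         ≈⟨ ⊗-identityʳ M ⟨
    M ⊗ I₃    ≈⟨ ⊗-congˡ M F-[] ⟨
    M ⊗ F []  ∎
    where open ≈-Reasoning ≈-setoid
  F-commute {M} gM≈Mg (x ∷ u) = begin
    F (x ∷ u) ⊗ M      ≈⟨ ⊗-congʳ M (F-∷ x u) ⟩
    (g x ⊗ F u) ⊗ M    ≈⟨ ⊗-assoc (g x) (F u) M ⟩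
    g x ⊗ (F u ⊗ M)    ≈⟨ ⊗-congˡ (g x) (F-commute {M} gM≈Mg u) ⟩
    g x ⊗ (M ⊗ F u)    ≈⟨ ⊗-assoc (g x) M (F u) ⟨
    (g x ⊗ M) ⊗ F u    ≈⟨ ⊗-congʳ (F u) (gM≈Mg x) ⟩
    (M ⊗ g x) ⊗ F u    ≈⟨ ⊗-assoc M (g x) (F u) ⟩
    M ⊗ (g x ⊗ F u)    ≈⟨ ⊗-congˡ M (F-∷ x u) ⟨
    M ⊗ F (x ∷ u)      ∎
    where open ≈-Reasoning ≈-setoid

  det-F : (∀ x → det (g x) ≡ 1ℚ) → ∀ u → det (F u) ≡ 1ℚ
  det-F det-g≡1 [] = det-cong F-[]
  det-F det-g≡1 (x ∷ u) = begin
    det (F (x ∷ u))        ≡⟨ det-cong (F-∷ x u) ⟩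
    det (g x ⊗ F u)        ≡⟨ det-⊗ (g x) (F u) ⟩
    det (g x) * det (F u)  ≡⟨ cong₂ _*_ (det-g≡1 x) (det-F det-g≡1 u) ⟩
    1ℚ * 1ℚ                ≡⟨⟩
    1ℚ                     ∎
    where open ≡-Reasoning

left : ℚ → ℚ → ℚ → Mat
left n c d = fromRows ((c * d ∷ n * d ∷ 0ℚ ∷ []) ∷ (0ℚ ∷ d ∷ 0ℚ ∷ []) ∷ (0ℚ ∷ 0ℚ ∷ d ∷ []) ∷ [])

left-⊗ : ∀ n c d n' c' d' → (left n c d ⊗ left n' c' d') ≈ left (n + c * n') (c * c') (d * d')
left-⊗ n c d n' c' d' ₀ ₀ = solve 6
  (λ n c d n' c' d' → c :* d :* (c' :* d') :+ n :* d :* con 0ℚ :+ con 0ℚ :* con 0ℚ := c :* c' :* (d :* d'))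
  refl n c d n' c' d'
left-⊗ n c d n' c' d' ₀ ₁ = solve 6
  (λ n c d n' c' d' → c :* d :* (n' :* d') :+ n :* d :* d' :+ con 0ℚ :* con 0ℚ := (n :+ c :* n') :* (d :* d'))
  refl n c d n' c' d'
left-⊗ n c d n' c' d' ₀ ₂ = solve 6
  (λ n c d n' c' d' → c :* d :* con 0ℚ :+ n :* d :* con 0ℚ :+ con 0ℚ :* d' := con 0ℚ)
  refl n c d n' c' d'
left-⊗ n c d n' c' d' ₁ ₀ = solve 6
  (λ n c d n' c' d' → con 0ℚ :* (c' :* d') :+ d :* con 0ℚ :+ con 0ℚ :* con 0ℚ := con 0ℚ)
  refl n c d n' c' d'
left-⊗ n c d n' c' d' ₁ ₁ = solve 6
  (λ n c d n' c' d' → con 0ℚ :* (n' :* d') :+ d :* d' :+ con 0ℚ :* con 0ℚ := d :* d')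
  refl n c d n' c' d'
left-⊗ n c d n' c' d' ₁ ₂ = solve 6
  (λ n c d n' c' d' → con 0ℚ :* con 0ℚ :+ d :* con 0ℚ :+ con 0ℚ :* d' := con 0ℚ)
  refl n c d n' c' d'
left-⊗ n c d n' c' d' ₂ ₀ = solve 6
  (λ n c d n' c' d' → con 0ℚ :* (c' :* d') :+ con 0ℚ :* con 0ℚ :+ d :* con 0ℚ := con 0ℚ)
  refl n c d n' c' d'
left-⊗ n c d n' c' d' ₂ ₁ = solve 6
  (λ n c d n' c' d' → con 0ℚ :* (n' :* d') :+ con 0ℚ :* d' :+ d :* con 0ℚ := con 0ℚ)
  refl n c d n' c' d'
left-⊗ n c d n' c' d' ₂ ₂ = solve 6
  (λ n c d n' c' d' → con 0ℚ :* con 0ℚ :+ con 0ℚ :* con 0ℚ :+ d :* d' := d :* d')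
  refl n c d n' c' d'

right : ℚ → ℚ → ℚ → Mat
right n c e = reverse (left n c e)

block : ℚ → ℚ → ℚ → ℚ → ℚ → Mat
block n c n' c' s = fromRows ((c * s ∷ n * s ∷ 0ℚ ∷ []) ∷ (0ℚ ∷ s ∷ 0ℚ ∷ []) ∷ (0ℚ ∷ n' * s ∷ c' * s ∷ []) ∷ [])

left-⊗-right : ∀ n c d n' c' e → (left n c d ⊗ right n' c' e) ≈ block n c n' c' (d * e)
left-⊗-right n c d n' c' e ₀ ₀ = solve 6
  (λ n c d n' c' e → (c :* d) :* e :+ (n :* d) :* con 0ℚ :+ con 0ℚ :* con 0ℚ := (c :* (d :* e)))
  refl n c d n' c' e
left-⊗-right n c d n' c' e ₀ ₁ = solve 6
  (λ n c d n' c' e → (c :* d) :* con 0ℚ :+ (n :* d) :* e :+ con 0ℚ :* (n' :* e) := (n :* (d :* e)))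
  refl n c d n' c' e
left-⊗-right n c d n' c' e ₀ ₂ = solve 6
  (λ n c d n' c' e → (c :* d) :* con 0ℚ :+ (n :* d) :* con 0ℚ :+ con 0ℚ :* (c' :* e) := con 0ℚ)
  refl n c d n' c' e
left-⊗-right n c d n' c' e ₁ ₀ = solve 6
  (λ n c d n' c' e → con 0ℚ :* e :+ d :* con 0ℚ :+ con 0ℚ :* con 0ℚ := con 0ℚ)
  refl n c d n' c' e
left-⊗-right n c d n' c' e ₁ ₁ = solve 6
  (λ n c d n' c' e → con 0ℚ :* con 0ℚ :+ d :* e :+ con 0ℚ :* (n' :* e) := (d :* e))
  refl n c d n' c' e
left-⊗-right n c d n' c' e ₁ ₂ = solve 6
  (λ n c d n' c' e → con 0ℚ :* con 0ℚ :+ d :* con 0ℚ :+ con 0ℚ :* (c' :* e) := con 0ℚ)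
  refl n c d n' c' e
left-⊗-right n c d n' c' e ₂ ₀ = solve 6
  (λ n c d n' c' e → con 0ℚ :* e :+ con 0ℚ :* con 0ℚ :+ d :* con 0ℚ := con 0ℚ)
  refl n c d n' c' e
left-⊗-right n c d n' c' e ₂ ₁ = solve 6
  (λ n c d n' c' e → con 0ℚ :* con 0ℚ :+ con 0ℚ :* e :+ d :* (n' :* e) := (n' :* (d :* e)))
  refl n c d n' c' e
left-⊗-right n c d n' c' e ₂ ₂ = solve 6
  (λ n c d n' c' e → con 0ℚ :* con 0ℚ :+ con 0ℚ :* con 0ℚ :+ d :* (c' :* e) := (c' :* (d :* e)))
  refl n c d n' c' e

det-block : ∀ n c n' c' s → det (block n c n' c' s) ≡ s * (s * s * c * c')
det-block = solve 5 (λ n c n' c' s →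
    c :* s :* (s :* (c' :* s) :- con 0ℚ :* (n' :* s))
    :- n :* s :* (con 0ℚ :* (c' :* s) :- con 0ℚ :* con 0ℚ)
    :+ con 0ℚ :* (con 0ℚ :* (n' :* s) :- s :* con 0ℚ)
  := s :* (s :* s :* c :* c')) refl

block-injective : ∀ {n c n' c' s m k m' k' t} r → s * r ≡ 1ℚ →
                  block n c n' c' s ≈ block m k m' k' t → n ≡ m × c ≡ k × n' ≡ m' × c' ≡ k'
block-injective {s = s} {t = t} r sr≡1 blocks =
  cancel (blocks ₀ ₁) , cancel (blocks ₀ ₀) , cancel (blocks ₂ ₁) , cancel (blocks ₂ ₂)
  where
  cancel : ∀ {x y} → x * s ≡ y * t → x ≡ y
  cancel {y = y} xs≡yt = *-cancelʳ-invertible r sr≡1 (trans xs≡yt (cong (y *_) (sym (blocks ₁ ₁))))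

factor : Bool → ℚ
factor false = half
factor true  = third

scale : Word → ℚ
scale []      = 1ℚ
scale (x ∷ u) = factor x * scale u

genL-left : ∀ x → genL x ≈ left (q (digit x)) (q (radix x)) (factor x)
genL-left false = ≈-by-evaluation A₀ (left (q 0) (q 8) half)
genL-left true  = ≈-by-evaluation A₁ (left (q 1) (q 27) third)

genR-reverse : ∀ x → genR x ≈ reverse (genL x)
genR-reverse false = ≈-by-evaluation B₀ (reverse A₀)
genR-reverse true  = ≈-by-evaluation B₁ (reverse A₁)

genL-genR-commute : ∀ x y → (genL x ⊗ genR y) ≈ (genR y ⊗ genL x)
genL-genR-commute false false = ≈-by-evaluation (A₀ ⊗ B₀) (B₀ ⊗ A₀)
genL-genR-commute false true  = ≈-by-evaluation (A₀ ⊗ B₁) (B₁ ⊗ A₀)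
genL-genR-commute true  false = ≈-by-evaluation (A₁ ⊗ B₀) (B₀ ⊗ A₁)
genL-genR-commute true  true  = ≈-by-evaluation (A₁ ⊗ B₁) (B₁ ⊗ A₁)

det-genL : ∀ x → det (genL x) ≡ 1ℚ
det-genL false = refl
det-genL true  = refl

det-genR : ∀ x → det (genR x) ≡ 1ℚ
det-genR false = refl
det-genR true  = refl

module L = Generated genL φL (λ _ _ → refl) (λ _ _ _ _ → refl)
module R = Generated genR φR (λ _ _ → refl) (λ _ _ _ _ → refl)

φL-left : ∀ u → φL u ≈ left (q (value u)) (q (weight u)) (scale u)
φL-left []      = ≈-by-evaluation I₃ (left (q 0) (q 1) 1ℚ)
φL-left (x ∷ u) = begin
  genL x ⊗ φL u
    ≈⟨ ⊗-cong (genL-left x) (φL-left u) ⟩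
  left (q d) (q r) (factor x) ⊗ left (q v) (q w) (scale u)
    ≈⟨ left-⊗ (q d) (q r) (factor x) (q v) (q w) (scale u) ⟩
  left (q d + q r * q v) (q r * q w) (scale (x ∷ u))
    ≡⟨ cong₂ (λ n c → left n c (scale (x ∷ u))) value-step (sym (q-homo-* r w)) ⟩
  left (q (value (x ∷ u))) (q (weight (x ∷ u))) (scale (x ∷ u))
    ∎
  where
  open ≈-Reasoning ≈-setoid
  d r v w : ℕ
  d = digit x
  r = radix x
  v = value u
  w = weight u
  value-step : q d + q r * q v ≡ q (d ℕ.+ r ℕ.* v)
  value-step = sym (trans (q-homo-+ d (r ℕ.* v)) (cong (_+_ (q d)) (q-homo-* r v)))

φR-reverse : ∀ v → φR v ≈ reverse (φL v)
φR-reverse []      = ≈-by-evaluation I₃ (reverse I₃)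
φR-reverse (x ∷ v) = ≈-trans (⊗-cong (genR-reverse x) (φR-reverse v)) (≈-sym (reverse-⊗ (genL x) (φL v)))

φR-right : ∀ v → φR v ≈ right (q (value v)) (q (weight v)) (scale v)
φR-right v = ≈-trans (φR-reverse v) (reverse-cong (φL-left v))

φ-block : ∀ u v → φ (u , v) ≈ block (q (value u)) (q (weight u)) (q (value v)) (q (weight v)) (scale u * scale v)
φ-block u v = ≈-trans (⊗-cong (φL-left u) (φR-right v))
                      (left-⊗-right (q (value u)) (q (weight u)) (scale u) (q (value v)) (q (weight v)) (scale v))

φL-φR-commute : ∀ u v → (φL u ⊗ φR v) ≈ (φR v ⊗ φL u)
φL-φR-commute u v = L.F-commute {φR v} genL-commutes-φR u
  where
  genL-commutes-φR : ∀ x → (genL x ⊗ φR v) ≈ (φR v ⊗ genL x)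
  genL-commutes-φR x = ≈-sym (R.F-commute {genL x} (λ y → ≈-sym (genL-genR-commute x y)) v)

det-φ : ∀ p → det (φ p) ≡ 1ℚ
det-φ (u , v) = trans (det-⊗ (φL u) (φR v)) (cong₂ _*_ (L.det-F det-genL u) (R.det-F det-genR v))

φ-homomorphism : ∀ p p' → φ (p · p') ≈ (φ p ⊗ φ p')
φ-homomorphism (u , v) (u' , v') = ≈-trans
  (⊗-cong (L.F-++ u u') (R.F-++ v v'))
  (⊗-interchange (φL u) (φL u') (φR v) (φR v') (φL-φR-commute u' v))

φ-injective : ∀ p p' → φ p ≈ φ p' → p ≡ p'
φ-injective (u , v) (u' , v') φp≈φp' =
  let (valueᵤ≡ , weightᵤ≡ , valueᵥ≡ , weightᵥ≡) = block-injective _ invertible blocks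
  in cong₂ _,_ (weight-value-injective u u' (q-injective weightᵤ≡) (q-injective valueᵤ≡))
               (weight-value-injective v v' (q-injective weightᵥ≡) (q-injective valueᵥ≡))
  where
  s : ℚ
  s = scale u * scale v
  blocks : block (q (value u)) (q (weight u)) (q (value v)) (q (weight v)) s
         ≈ block (q (value u')) (q (weight u')) (q (value v')) (q (weight v')) (scale u' * scale v')
  blocks = ≈-trans (≈-sym (φ-block u v)) (≈-trans φp≈φp' (φ-block u' v'))
  invertible : s * (s * s * q (weight u) * q (weight v)) ≡ 1ℚ
  invertible = trans (sym (det-block (q (value u)) (q (weight u)) (q (value v)) (q (weight v)) s))
                     (trans (sym (det-cong (φ-block u v))) (det-φ (u , v)))

theorem7 : ((p : WordPair) → det (φ p) ≡ 1ℚ)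
           × (φ εε ≈ I₃)
           × ((p p' : WordPair) → φ (p · p') ≈ (φ p ⊗ φ p'))
           × ((p p' : WordPair) → φ p ≈ φ p' → p ≡ p')
theorem7 = det-φ , ⊗-identityˡ I₃ , φ-homomorphism , φ-injective
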